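{- Let $n\ge 1$. Let $\Phi_n$ be the poset whose vertex set is $\{0,1\}^n$, whose partial order is the one generated by the covering relation: $y$ covers $x$ if and only if $y-x$ (coordinatewise difference) is an alternating sequence. Then the alternating sign matrices of order $n$ are in bijection with the maximal chains of $\Phi_n$. Explicitly: given a maximal chain $x_0<x_1<\cdots<x_n$ in $\Phi_n$, the corresponding alternating sign matrix has row $i$ equal to $x_i-x_{i-1}$ for $1\le i\le n$; conversely, given an alternating sign matrix of order $n$, letting $x_i$ be the sum of its rows $1,2,\ldots,i$ $(0\le i\le n)$, the sequence $x_0<x_1<\cdots<x_n$ is the corresponding maximal chain of $\Phi_n$.
   Context: A sequence $(\alpha_1,\ldots,\alpha_n)$ is alternating if each $\alpha_i\in\{1,0,-1\}$ and its nonzero entries, read left to right, form the pattern $1,-1,1,-1,\ldots,-1,1$. An alternating sign matrix of order $n$ is an $n\times n$ matrix each of whose rows and columns is alternating. The rank of a vertex of $\Phi_n$ is its number of nonzero coordinates; if $y$ covers $x$ then the rank of $y$ is one more than that of $x$. A chain $x_0<\cdots<x_r$ is maximal if $x_r$ is a maximal element, $x_0$ is a minimal element, and $x_i$ covers $x_{i-1}$ for $1\le i\le r$. ($\Phi_n$ has unique minimum $(0,\ldots,0)$ and unique maximum $(1,\ldots,1)$, and its maximal chains are exactly the chains of length $n$.) -}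

module Defs where

open import Data.Nat using (ℕ; zero; suc)
open import Data.Integer using (ℤ; _+_; _-_; 0ℤ; 1ℤ; -1ℤ)
open import Data.Fin using (Fin; zero; suc; inject₁; fromℕ; toℕ)
open import Data.List using (List; []; _∷_)
open import Data.Product using (_×_; Σ)
open import Data.Sum using (_⊎_)
open import Relation.Binary.PropositionalEquality using (_≡_)
open import Relation.Nullary using (¬_; yes; no)
open import Relation.Binary.Construct.Closure.ReflexiveTransitive using (Star)
import Data.Integer.Properties as ℤP

ℤVec : ℕ → Set
ℤVec n = Fin n → ℤ

nonzeros : ∀ {n} → ℤVec n → List ℤ
nonzeros {zero} a = []
nonzeros {suc n} a with a zero ℤP.≟ 0ℤ
... | yes _ = nonzeros (λ i → a (suc i))
... | no _  = a zero ∷ nonzeros (λ i → a (suc i))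

data AltPattern : List ℤ → Set where
  single : AltPattern (1ℤ ∷ [])
  step   : ∀ {l} → AltPattern l → AltPattern (1ℤ ∷ -1ℤ ∷ l)

Alternating : ∀ {n} → ℤVec n → Set
Alternating a = (∀ i → (a i ≡ 1ℤ ⊎ a i ≡ 0ℤ ⊎ a i ≡ -1ℤ)) × AltPattern (nonzeros a)

IsVertex : ∀ {n} → ℤVec n → Set
IsVertex x = ∀ i → (x i ≡ 0ℤ ⊎ x i ≡ 1ℤ)

_⊖_ : ∀ {n} → ℤVec n → ℤVec n → ℤVec n
(y ⊖ x) i = y i - x i

Covers : ∀ {n} → ℤVec n → ℤVec n → Set
Covers y x = IsVertex x × IsVertex y × Alternating (y ⊖ x)

CoveredBy : ∀ {n} → ℤVec n → ℤVec n → Set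
CoveredBy x y = Covers y x

_≤Φ_ : ∀ {n} → ℤVec n → ℤVec n → Set
x ≤Φ y = Star CoveredBy x y

_≐_ : ∀ {n} → ℤVec n → ℤVec n → Set
x ≐ y = ∀ i → x i ≡ y i

_<Φ_ : ∀ {n} → ℤVec n → ℤVec n → Set
x <Φ y = x ≤Φ y × ¬ (x ≐ y)

IsMinimal : ∀ {n} → ℤVec n → Set
IsMinimal {n} x = IsVertex x × (∀ (z : ℤVec n) → IsVertex z → ¬ (z <Φ x))

IsMaximal : ∀ {n} → ℤVec n → Set
IsMaximal {n} x = IsVertex x × (∀ (z : ℤVec n) → IsVertex z → ¬ (x <Φ z))

IsMaximalChain : (n r : ℕ) → (Fin (suc r) → ℤVec n) → Set
IsMaximalChain n r x =
  (∀ i → IsVertex (x i)) ×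
  IsMinimal (x zero) ×
  IsMaximal (x (fromℕ r)) ×
  (∀ (i : Fin r) → Covers (x (suc i)) (x (inject₁ i)))

Matrix : ℕ → Set
Matrix n = Fin n → Fin n → ℤ

IsASM : (n : ℕ) → Matrix n → Set
IsASM n A = (∀ i → Alternating (λ j → A i j)) × (∀ j → Alternating (λ i → A i j))

-- sum of the first m entries of a vector (all entries if m ≥ n)
sumFirst : ∀ {n} → ℤVec n → ℕ → ℤ
sumFirst {zero} f m = 0ℤ
sumFirst {suc n} f zero = 0ℤ
sumFirst {suc n} f (suc m) = f zero + sumFirst (λ k → f (suc k)) m

partialSums : ∀ {n} → Matrix n → Fin (suc n) → ℤVec n
partialSums A i j = sumFirst (λ k → A k j) (toℕ i)

-- row i (i = 1..n) is x_i - x_{i-1}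
differences : ∀ {n} → (Fin (suc n) → ℤVec n) → Matrix n
differences x i j = x (suc i) j - x (inject₁ i) j

-- Read the nonzero entries of a sequence as moves of a bit that each toggle it
-- (1 sets it, -1 clears it).  A sequence is alternating exactly when this bit,
-- started at 0, stays in {0,1} and ends at 1; equivalently, when its prefix sums
-- are 0/1-valued and its total is 1.  Applied to the columns of a matrix, this
-- says that the partial row sums of an ASM are vertices of Φ_n running from
-- 0⋯0 to 1⋯1, and conversely that the columns of the row differences of such a
-- chain are alternating; the rows are alternating because consecutive vertices
-- of the chain are covers.  Since every cover raises the coordinate sum by one,
-- a maximal chain, which must run from 0⋯0 to 1⋯1, has length exactly n.
module Submission where

open import Defs
open import Data.Nat using (ℕ; suc; _≤_)
open import Data.Fin using (Fin)
open import Data.Product using (_×_)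
open import Relation.Binary.PropositionalEquality using (_≡_)

import Data.Nat as ℕ
open import Data.Fin using (zero; suc; inject₁; fromℕ; toℕ; _≟_)
open import Data.Fin.Properties using (toℕ-inject₁; toℕ-fromℕ)
open import Data.Integer as ℤ using (ℤ; +_; 0ℤ; 1ℤ; -1ℤ; _+_; _-_; +≤+)
open import Data.Integer.Properties as ℤP using (+-identityˡ; +-identityʳ; +-inverseʳ; +-assoc)
open import Data.Integer.Tactic.RingSolver using (solve-∀)
open import Data.Bool using (Bool; true; false)
open import Data.List using (List; []; _∷_)
open import Data.Product using (∃-syntax; _,_; proj₁; proj₂)
open import Data.Sum using (_⊎_; inj₁; inj₂)
open import Data.Vec.Functional using (tail; updateAt)
open import Data.Vec.Functional.Properties using (updateAt-updates; updateAt-minimal)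
open import Function using (const)
open import Relation.Nullary using (¬_; yes; no; contradiction)
open import Relation.Binary.PropositionalEquality using (_≢_; refl; sym; trans; cong; cong₂; subst; module ≡-Reasoning)
open import Relation.Binary.Construct.Closure.ReflexiveTransitive using (ε; _◅_)

Bit : ℤ → Set
Bit z = z ≡ 0ℤ ⊎ z ≡ 1ℤ

SignEntry : ℤ → Set
SignEntry z = z ≡ 1ℤ ⊎ z ≡ 0ℤ ⊎ z ≡ -1ℤ

⟦_⟧ : Bool → ℤ
⟦ false ⟧ = 0ℤ
⟦ true ⟧ = 1ℤ

⟦⟧+0-bit : ∀ s → Bit (⟦ s ⟧ + 0ℤ)
⟦⟧+0-bit false = inj₁ refl
⟦⟧+0-bit true = inj₂ refl

⟦⟧-injective : ∀ {s t} → ⟦ s ⟧ ≡ ⟦ t ⟧ → s ≡ t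
⟦⟧-injective {false} {false} _ = refl
⟦⟧-injective {true} {true} _ = refl

bit⇒⟦⟧ : ∀ {z} → Bit z → ∃[ s ] z ≡ ⟦ s ⟧
bit⇒⟦⟧ (inj₁ z≡0) = false , z≡0
bit⇒⟦⟧ (inj₂ z≡1) = true , z≡1

bit-difference : ∀ {a b} → Bit a → Bit b → SignEntry (a - b)
bit-difference (inj₁ refl) (inj₁ refl) = inj₂ (inj₁ refl)
bit-difference (inj₁ refl) (inj₂ refl) = inj₂ (inj₂ refl)
bit-difference (inj₂ refl) (inj₁ refl) = inj₁ refl
bit-difference (inj₂ refl) (inj₂ refl) = inj₂ (inj₁ refl)

Walk : Bool → List ℤ → Bool → Set
Walk s [] t = s ≡ t
Walk false (d ∷ ds) t = d ≡ 1ℤ × Walk true ds t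
Walk true (d ∷ ds) t = d ≡ -1ℤ × Walk false ds t

altPattern⇒walk : ∀ {ds} → AltPattern ds → Walk false ds true
altPattern⇒walk single = refl , refl
altPattern⇒walk (step p) = refl , refl , altPattern⇒walk p

walk⇒altPattern : ∀ ds → Walk false ds true → AltPattern ds
walk⇒altPattern (_ ∷ []) (refl , refl) = single
walk⇒altPattern (_ ∷ _ ∷ ds) (refl , refl , w) = step (walk⇒altPattern ds w)

walk-uncons : ∀ {n} (a : ℤVec (suc n)) {s t} → Walk s (nonzeros a) t →
  ∃[ s′ ] (⟦ s ⟧ + a zero ≡ ⟦ s′ ⟧ × Walk s′ (nonzeros (tail a)) t)
walk-uncons a {s} w with a zero ℤP.≟ 0ℤ
... | yes a₀≡0 = s , trans (cong (_+_ ⟦ s ⟧) a₀≡0) (+-identityʳ ⟦ s ⟧) , w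
walk-uncons a {false} (a₀≡1 , w) | no _ = true , trans (+-identityˡ (a zero)) a₀≡1 , w
walk-uncons a {true} (a₀≡-1 , w) | no _ = false , cong (_+_ 1ℤ) a₀≡-1 , w

walk-cons : ∀ {n} (a : ℤVec (suc n)) {s s′ t} → a zero ≡ ⟦ s′ ⟧ - ⟦ s ⟧ →
  Walk s′ (nonzeros (tail a)) t → Walk s (nonzeros a) t
walk-cons a {false} {false} a₀≡0 w with a zero ℤP.≟ 0ℤ
... | yes _ = w
... | no a₀≢0 = contradiction a₀≡0 a₀≢0
walk-cons a {true} {true} a₀≡0 w with a zero ℤP.≟ 0ℤ
... | yes _ = w
... | no a₀≢0 = contradiction a₀≡0 a₀≢0
walk-cons a {false} {true} a₀≡1 w with a zero ℤP.≟ 0ℤ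
... | yes a₀≡0 = contradiction (trans (sym a₀≡1) a₀≡0) λ ()
... | no _ = a₀≡1 , w
walk-cons a {true} {false} a₀≡-1 w with a zero ℤP.≟ 0ℤ
... | yes a₀≡0 = contradiction (trans (sym a₀≡-1) a₀≡0) λ ()
... | no _ = a₀≡-1 , w

-- On vertices of Φ_n, total is the rank.
total : ∀ {n} → ℤVec n → ℤ
total {n} a = sumFirst a n

walk⇒prefixSums : ∀ {n} (a : ℤVec n) {s t} → Walk s (nonzeros a) t →
  (∀ m → Bit (⟦ s ⟧ + sumFirst a m)) × ⟦ s ⟧ + total a ≡ ⟦ t ⟧
walk⇒prefixSums {ℕ.zero} a {s} refl = (λ _ → ⟦⟧+0-bit s) , +-identityʳ ⟦ s ⟧
walk⇒prefixSums {suc n} a {s} {t} w with walk-uncons a w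
... | s′ , s+a₀≡s′ , w′ = prefix-bit , trans (shift (total (tail a))) (proj₂ rest)
  where
  rest : (∀ m → Bit (⟦ s′ ⟧ + sumFirst (tail a) m)) × ⟦ s′ ⟧ + total (tail a) ≡ ⟦ t ⟧
  rest = walk⇒prefixSums (tail a) w′
  shift : ∀ z → ⟦ s ⟧ + (a zero + z) ≡ ⟦ s′ ⟧ + z
  shift z = trans (sym (+-assoc ⟦ s ⟧ (a zero) z)) (cong (_+ z) s+a₀≡s′)
  prefix-bit : ∀ m → Bit (⟦ s ⟧ + sumFirst a m)
  prefix-bit ℕ.zero = ⟦⟧+0-bit s
  prefix-bit (suc m) = subst Bit (sym (shift _)) (proj₁ rest m)

alternating-prefixSum-bit : ∀ {n} {a : ℤVec n} → Alternating a → ∀ m → Bit (sumFirst a m)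
alternating-prefixSum-bit {a = a} (_ , p) m =
  subst Bit (+-identityˡ (sumFirst a m)) (proj₁ (walk⇒prefixSums a (altPattern⇒walk p)) m)

alternating-total : ∀ {n} {a : ℤVec n} → Alternating a → total a ≡ 1ℤ
alternating-total {a = a} (_ , p) =
  trans (sym (+-identityˡ (total a))) (proj₂ (walk⇒prefixSums a (altPattern⇒walk p)))

bitPath⇒walk : ∀ n (b : Fin (suc n) → ℤ) {s t} → b zero ≡ ⟦ s ⟧ → b (fromℕ n) ≡ ⟦ t ⟧ →
  (∀ i → Bit (b i)) → Walk s (nonzeros (λ (i : Fin n) → b (suc i) - b (inject₁ i))) t
bitPath⇒walk ℕ.zero b b₀≡s b₀≡t _ = ⟦⟧-injective (trans (sym b₀≡s) b₀≡t)
bitPath⇒walk (suc n) b b₀≡s bₙ≡t bits with bit⇒⟦⟧ (bits (suc zero))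
... | s′ , b₁≡s′ = walk-cons (λ i → b (suc i) - b (inject₁ i)) (cong₂ _-_ b₁≡s′ b₀≡s)
                     (bitPath⇒walk n (tail b) b₁≡s′ bₙ≡t (λ i → bits (suc i)))

bitPath-differences-alternating : ∀ n (b : Fin (suc n) → ℤ) → b zero ≡ 0ℤ → b (fromℕ n) ≡ 1ℤ →
  (∀ i → Bit (b i)) → Alternating (λ (i : Fin n) → b (suc i) - b (inject₁ i))
bitPath-differences-alternating n b b₀≡0 bₙ≡1 bits =
  (λ i → bit-difference (bits (suc i)) (bits (inject₁ i))) ,
  walk⇒altPattern _ (bitPath⇒walk n b b₀≡0 bₙ≡1 bits)

nonzeros-cong : ∀ {n} {a b : ℤVec n} → a ≐ b → nonzeros a ≡ nonzeros b
nonzeros-cong {ℕ.zero} _ = refl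
nonzeros-cong {suc n} {a} {b} a≐b with a zero ℤP.≟ 0ℤ | b zero ℤP.≟ 0ℤ
... | yes _ | yes _ = nonzeros-cong (λ i → a≐b (suc i))
... | no _ | no _ = cong₂ _∷_ (a≐b zero) (nonzeros-cong (λ i → a≐b (suc i)))
... | yes a₀≡0 | no b₀≢0 = contradiction (trans (sym (a≐b zero)) a₀≡0) b₀≢0
... | no a₀≢0 | yes b₀≡0 = contradiction (trans (a≐b zero) b₀≡0) a₀≢0

alternating-cong : ∀ {n} {a b : ℤVec n} → a ≐ b → Alternating a → Alternating b
alternating-cong a≐b (entries , p) =
  (λ i → subst SignEntry (a≐b i) (entries i)) , subst AltPattern (nonzeros-cong a≐b) p

δ : ∀ {n} → Fin n → ℤVec n
δ j = updateAt (const 0ℤ) j (const 1ℤ)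

nonzeros-zeros : ∀ n → nonzeros {n} (const 0ℤ) ≡ []
nonzeros-zeros ℕ.zero = refl
nonzeros-zeros (suc n) = nonzeros-zeros n

δ-alternating : ∀ {n} (j : Fin n) → Alternating (δ j)
δ-alternating {suc n} zero = entries , subst AltPattern (sym (cong (1ℤ ∷_) (nonzeros-zeros n))) single
  where
  entries : ∀ i → SignEntry (δ zero i)
  entries zero = inj₁ refl
  entries (suc _) = inj₂ (inj₁ refl)
δ-alternating {suc n} (suc j) with δ-alternating j
... | entries , p = (λ { zero → inj₂ (inj₁ refl) ; (suc i) → entries i }) , p

⊖≐δ : ∀ {n} {y x : ℤVec n} (j : Fin n) → y j ≡ 1ℤ → x j ≡ 0ℤ →
  (∀ i → i ≢ j → y i ≡ x i) → (y ⊖ x) ≐ δ j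
⊖≐δ {x = x} j yⱼ≡1 xⱼ≡0 agree i with i ≟ j
... | yes refl = trans (cong₂ _-_ yⱼ≡1 xⱼ≡0) (sym (updateAt-updates j (const 0ℤ)))
... | no i≢j = trans (trans (cong (_- x i) (agree i i≢j)) (+-inverseʳ (x i)))
                     (sym (updateAt-minimal i j (const 0ℤ) i≢j))

updateAt-vertex : ∀ {n} {x : ℤVec n} (j : Fin n) {v} → IsVertex x → Bit v →
  IsVertex (updateAt x j (const v))
updateAt-vertex {x = x} j vx bit-v i with i ≟ j
... | yes refl = subst Bit (sym (updateAt-updates j x)) bit-v
... | no i≢j = subst Bit (sym (updateAt-minimal i j x i≢j)) (vx i)

δ-covers : ∀ {n} {y x : ℤVec n} (j : Fin n) → IsVertex y → IsVertex x → (y ⊖ x) ≐ δ j → Covers y x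
δ-covers j vy vx y⊖x≐δ = vx , vy , alternating-cong (λ i → sym (y⊖x≐δ i)) (δ-alternating j)

total-⊖ : ∀ {n} (y x : ℤVec n) → total (y ⊖ x) ≡ total y - total x
total-⊖ {ℕ.zero} _ _ = refl
total-⊖ {suc n} y x = begin
  (y zero - x zero) + total (tail y ⊖ tail x)
      ≡⟨ cong (_+_ (y zero - x zero)) (total-⊖ (tail y) (tail x)) ⟩
  (y zero - x zero) + (total (tail y) - total (tail x))
      ≡⟨ interchange (y zero) (x zero) (total (tail y)) (total (tail x)) ⟩
  (y zero + total (tail y)) - (x zero + total (tail x)) ∎
  where
  open ≡-Reasoning
  interchange : ∀ a b c d → (a - b) + (c - d) ≡ (a + c) - (b + d)
  interchange = solve-∀

total-cong : ∀ {n} {x y : ℤVec n} → x ≐ y → total x ≡ total y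
total-cong {ℕ.zero} _ = refl
total-cong {suc n} x≐y = cong₂ _+_ (x≐y zero) (total-cong (λ i → x≐y (suc i)))

total-zeros : ∀ n → total {n} (const 0ℤ) ≡ 0ℤ
total-zeros ℕ.zero = refl
total-zeros (suc n) = cong (_+_ 0ℤ) (total-zeros n)

total-ones : ∀ n → total {n} (const 1ℤ) ≡ + n
total-ones ℕ.zero = refl
total-ones (suc n) = cong (_+_ 1ℤ) (total-ones n)

vertex-total-nonneg : ∀ {n} {x : ℤVec n} → IsVertex x → 0ℤ ℤ.≤ total x
vertex-total-nonneg {ℕ.zero} _ = ℤP.≤-refl
vertex-total-nonneg {suc n} vx = ℤP.+-mono-≤ (bit-nonneg (vx zero)) (vertex-total-nonneg (λ i → vx (suc i)))
  where
  bit-nonneg : ∀ {z} → Bit z → 0ℤ ℤ.≤ z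
  bit-nonneg (inj₁ refl) = +≤+ ℕ.z≤n
  bit-nonneg (inj₂ refl) = +≤+ ℕ.z≤n

vertex-total-≤ : ∀ {n} {x : ℤVec n} → IsVertex x → total x ℤ.≤ + n
vertex-total-≤ {ℕ.zero} _ = ℤP.≤-refl
vertex-total-≤ {suc n} vx = ℤP.+-mono-≤ (bit-≤1 (vx zero)) (vertex-total-≤ (λ i → vx (suc i)))
  where
  bit-≤1 : ∀ {z} → Bit z → z ℤ.≤ 1ℤ
  bit-≤1 (inj₁ refl) = +≤+ ℕ.z≤n
  bit-≤1 (inj₂ refl) = ℤP.≤-refl

cover-total : ∀ {n} {y x : ℤVec n} → Covers y x → total y ≡ ℤ.suc (total x)
cover-total {y = y} {x} (_ , _ , y⊖x-alt) = begin
  total y                          ≡⟨ split-difference (total y) (total x) ⟩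
  total x + (total y - total x)    ≡⟨ cong (_+_ (total x)) (sym (total-⊖ y x)) ⟩
  total x + total (y ⊖ x)          ≡⟨ cong (_+_ (total x)) (alternating-total y⊖x-alt) ⟩
  total x + 1ℤ                     ≡⟨ ℤP.+-comm (total x) 1ℤ ⟩
  ℤ.suc (total x)                  ∎
  where
  open ≡-Reasoning
  split-difference : ∀ a b → a ≡ b + (a - b)
  split-difference = solve-∀

≤Φ⇒total-≤ : ∀ {n} {x y : ℤVec n} → x ≤Φ y → total x ℤ.≤ total y
≤Φ⇒total-≤ ε = ℤP.≤-refl
≤Φ⇒total-≤ {x = x} (cover ◅ rest) =
  ℤP.≤-trans (ℤP.i≤j+i (total x) 1ℤ) (subst (ℤ._≤ _) (cover-total cover) (≤Φ⇒total-≤ rest))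

<Φ⇒total-< : ∀ {n} {x y : ℤVec n} → x <Φ y → total x ℤ.< total y
<Φ⇒total-< (ε , x≉x) = contradiction (λ _ → refl) x≉x
<Φ⇒total-< (cover ◅ rest , _) =
  ℤP.suc[i]≤j⇒i<j (subst (ℤ._≤ _) (cover-total cover) (≤Φ⇒total-≤ rest))

zeros-minimal : ∀ {n} {x : ℤVec n} → x ≐ const 0ℤ → IsMinimal x
zeros-minimal {n} {x} x≐0 = (λ i → inj₁ (x≐0 i)) , λ z vz z<x →
  ℤP.<-irrefl refl (ℤP.≤-<-trans (vertex-total-nonneg vz)
                     (subst (total z ℤ.<_) (trans (total-cong x≐0) (total-zeros n)) (<Φ⇒total-< z<x)))

ones-maximal : ∀ {n} {x : ℤVec n} → x ≐ const 1ℤ → IsMaximal x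
ones-maximal {n} {x} x≐1 = (λ i → inj₂ (x≐1 i)) , λ z vz x<z →
  ℤP.<-irrefl refl (ℤP.<-≤-trans
                     (subst (ℤ._< total z) (trans (total-cong x≐1) (total-ones n)) (<Φ⇒total-< x<z))
                     (vertex-total-≤ vz))

-- A coordinate equal to 1 could be cleared to give a vertex covered by x;
-- dually, one equal to 0 could be set to give a vertex covering x.
minimal⇒zeros : ∀ {n} {x : ℤVec n} → IsMinimal x → x ≐ const 0ℤ
minimal⇒zeros {x = x} (vx , minimal) j with vx j
... | inj₁ xⱼ≡0 = xⱼ≡0
... | inj₂ xⱼ≡1 = contradiction (z◃x ◅ ε , z≉x) (minimal z vz)
  where
  z = updateAt x j (const 0ℤ)
  zⱼ≡0 : z j ≡ 0ℤ
  zⱼ≡0 = updateAt-updates j x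
  vz : IsVertex z
  vz = updateAt-vertex j vx (inj₁ refl)
  z◃x : Covers x z
  z◃x = δ-covers j vx vz (⊖≐δ j xⱼ≡1 zⱼ≡0 λ i i≢j → sym (updateAt-minimal i j x i≢j))
  z≉x : ¬ (z ≐ x)
  z≉x z≐x = contradiction (trans (sym zⱼ≡0) (trans (z≐x j) xⱼ≡1)) λ ()

maximal⇒ones : ∀ {n} {x : ℤVec n} → IsMaximal x → x ≐ const 1ℤ
maximal⇒ones {x = x} (vx , maximal) j with vx j
... | inj₂ xⱼ≡1 = xⱼ≡1
... | inj₁ xⱼ≡0 = contradiction (x◃z ◅ ε , x≉z) (maximal z vz)
  where
  z = updateAt x j (const 1ℤ)
  zⱼ≡1 : z j ≡ 1ℤ
  zⱼ≡1 = updateAt-updates j x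
  vz : IsVertex z
  vz = updateAt-vertex j vx (inj₂ refl)
  x◃z : Covers z x
  x◃z = δ-covers j vz vx (⊖≐δ j zⱼ≡1 xⱼ≡0 λ i i≢j → updateAt-minimal i j x i≢j)
  x≉z : ¬ (x ≐ z)
  x≉z x≐z = contradiction (trans (sym xⱼ≡0) (trans (x≐z j) zⱼ≡1)) λ ()

chain-total : ∀ {n} r (x : Fin (suc r) → ℤVec n) → (∀ (i : Fin r) → Covers (x (suc i)) (x (inject₁ i))) →
  total (x (fromℕ r)) ≡ + r + total (x zero)
chain-total ℕ.zero x _ = sym (+-identityˡ (total (x zero)))
chain-total (suc r) x covers = begin
  total (x (fromℕ (suc r)))                 ≡⟨ cover-total (covers (fromℕ r)) ⟩
  1ℤ + total (x (inject₁ (fromℕ r)))        ≡⟨ cong (_+_ 1ℤ) (chain-total r (λ i → x (inject₁ i)) (λ i → covers (inject₁ i))) ⟩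
  1ℤ + (+ r + total (x zero))               ≡⟨ sym (+-assoc 1ℤ (+ r) (total (x zero))) ⟩
  + suc r + total (x zero)                  ∎
  where open ≡-Reasoning

maximalChain-length : ∀ {n} r (x : Fin (suc r) → ℤVec n) → IsMaximalChain n r x → r ≡ n
maximalChain-length {n} r x (_ , bottom , top , covers) = ℤP.+-injective (begin
  + r                           ≡⟨ sym (+-identityʳ (+ r)) ⟩
  + r + 0ℤ                      ≡⟨ cong (_+_ (+ r)) (sym (trans (total-cong (minimal⇒zeros bottom)) (total-zeros n))) ⟩
  + r + total (x zero)          ≡⟨ sym (chain-total r x covers) ⟩
  total (x (fromℕ r))           ≡⟨ trans (total-cong (maximal⇒ones top)) (total-ones n) ⟩
  + n                           ∎)
  where open ≡-Reasoning

sumFirst-zero : ∀ {n} (f : ℤVec n) → sumFirst f 0 ≡ 0ℤ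
sumFirst-zero {ℕ.zero} _ = refl
sumFirst-zero {suc n} _ = refl

sumFirst-through : ∀ {n} (f : ℤVec n) (i : Fin n) → sumFirst f (suc (toℕ i)) ≡ sumFirst f (toℕ i) + f i
sumFirst-through f zero =
  trans (cong (_+_ (f zero)) (sumFirst-zero (tail f))) (trans (+-identityʳ (f zero)) (sym (+-identityˡ (f zero))))
sumFirst-through f (suc i) =
  trans (cong (_+_ (f zero)) (sumFirst-through (tail f) i)) (sym (+-assoc (f zero) _ _))

sumFirst-telescopes : ∀ {r} (b : Fin (suc r) → ℤ) (i : Fin (suc r)) →
  sumFirst (λ k → b (suc k) - b (inject₁ k)) (toℕ i) ≡ b i - b zero
sumFirst-telescopes {r} b zero = trans (sumFirst-zero {r} _) (sym (+-inverseʳ (b zero)))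
sumFirst-telescopes {suc r} b (suc i) = begin
  (b (suc zero) - b zero) + sumFirst (λ k → b (suc (suc k)) - b (suc (inject₁ k))) (toℕ i)
      ≡⟨ cong (_+_ (b (suc zero) - b zero)) (sumFirst-telescopes (tail b) i) ⟩
  (b (suc zero) - b zero) + (b (suc i) - b (suc zero))
      ≡⟨ chain (b zero) (b (suc zero)) (b (suc i)) ⟩
  b (suc i) - b zero ∎
  where
  open ≡-Reasoning
  chain : ∀ a b c → (b - a) + (c - b) ≡ c - a
  chain = solve-∀

differences-partialSums : ∀ {n} (A : Matrix n) i j → differences (partialSums A) i j ≡ A i j
differences-partialSums {n} A i j = begin
  sumFirst column (suc (toℕ i)) - sumFirst column (toℕ (inject₁ i))
      ≡⟨ cong₂ _-_ (sumFirst-through column i) (cong (sumFirst column) (toℕ-inject₁ i)) ⟩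
  (sumFirst column (toℕ i) + A i j) - sumFirst column (toℕ i)
      ≡⟨ cancel (A i j) (sumFirst column (toℕ i)) ⟩
  A i j ∎
  where
  open ≡-Reasoning
  column : ℤVec n
  column k = A k j
  cancel : ∀ a b → (b + a) - b ≡ a
  cancel = solve-∀

partialSums-differences : ∀ {n} (x : Fin (suc n) → ℤVec n) → x zero ≐ const 0ℤ →
  ∀ i j → partialSums (differences x) i j ≡ x i j
partialSums-differences x x₀≐0 i j =
  trans (sumFirst-telescopes (λ k → x k j) i) (trans (cong (_-_ (x i j)) (x₀≐0 j)) (+-identityʳ (x i j)))

asm⇒maximalChain : ∀ n (A : Matrix n) → IsASM n A → IsMaximalChain n n (partialSums A)
asm⇒maximalChain n A (rows , columns) = vertices , zeros-minimal bottom , ones-maximal top , covers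
  where
  vertices : ∀ i → IsVertex (partialSums A i)
  vertices i j = alternating-prefixSum-bit (columns j) (toℕ i)
  bottom : partialSums A zero ≐ const 0ℤ
  bottom j = sumFirst-zero (λ k → A k j)
  top : partialSums A (fromℕ n) ≐ const 1ℤ
  top j = trans (cong (sumFirst (λ k → A k j)) (toℕ-fromℕ n)) (alternating-total (columns j))
  covers : ∀ (i : Fin n) → Covers (partialSums A (suc i)) (partialSums A (inject₁ i))
  covers i = vertices (inject₁ i) , vertices (suc i) ,
             alternating-cong (λ j → sym (differences-partialSums A i j)) (rows i)

maximalChain⇒asm : ∀ n (x : Fin (suc n) → ℤVec n) → IsMaximalChain n n x → IsASM n (differences x)
maximalChain⇒asm n x (vertices , bottom , top , covers) = rows , columns
  where
  rows : ∀ i → Alternating (λ j → differences x i j)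
  rows i = proj₂ (proj₂ (covers i))
  columns : ∀ j → Alternating (λ i → differences x i j)
  columns j = bitPath-differences-alternating n (λ k → x k j)
                (minimal⇒zeros bottom j) (maximal⇒ones top j) (λ k → vertices k j)

theorem3p2 : (n : ℕ) → 1 ≤ n →
    ((A : Matrix n) → IsASM n A → IsMaximalChain n n (partialSums A)) ×
    ((r : ℕ) (x : Fin (suc r) → ℤVec n) → IsMaximalChain n r x → r ≡ n) ×
    ((x : Fin (suc n) → ℤVec n) → IsMaximalChain n n x → IsASM n (differences x)) ×
    ((A : Matrix n) → IsASM n A → ∀ i j → differences (partialSums A) i j ≡ A i j) ×
    ((x : Fin (suc n) → ℤVec n) → IsMaximalChain n n x → ∀ i j → partialSums (differences x) i j ≡ x i j)
theorem3p2 n _ =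
  asm⇒maximalChain n ,
  maximalChain-length ,
  maximalChain⇒asm n ,
  (λ A _ → differences-partialSums A) ,
  λ x (_ , bottom , _) → partialSums-differences x (minimal⇒zeros bottom)
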